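{- If $T$ has SOP$_1$, then $T$ is not simple. In fact, if $\varphi(\bar x,\bar y)$ exemplifies SOP$_1$ of $T$, then $\varphi(\bar x,\bar y)$ has the tree property: there are $\bar b_\nu$ ($\nu\in{}^{\omega>}\omega$) such that for each $\nu\in{}^{\omega>}\omega$ the formulas $\varphi(\bar x,\bar b_{\nu^\frown\langle k\rangle})$, $k<\omega$, are pairwise contradictory, and for each $\nu\in{}^\omega\omega$ the set $\{\varphi(\bar x,\bar b_{\nu\restriction n}):n<\omega\}$ is consistent.
   Context: $T$ is a complete first-order theory with monster model $\mathfrak{C}$. A formula $\varphi(\bar x,\bar y)$ exemplifies SOP$_1$ if there are $\bar a_\eta$ ($\eta\in{}^{\omega>}2$) in $\mathfrak{C}$ such that (a) for every $\rho\in{}^\omega2$, $\{\varphi(\bar x,\bar a_{\rho\restriction n}):n<\omega\}$ is consistent; (b) if $\nu^\frown\langle0\rangle\trianglelefteq\eta\in{}^{\omega>}2$ then $\{\varphi(\bar x,\bar a_\eta),\varphi(\bar x,\bar a_{\nu^\frown\langle1\rangle})\}$ is inconsistent. $T$ has SOP$_1$ if some formula exemplifies it. $T$ is simple iff no formula has the tree property. -}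

module Defs where

open import Data.Nat using (ℕ; zero; suc; _+_; _≤_)
open import Data.Fin using (Fin)
open import Data.Bool using (Bool; true; false)
open import Data.List using (List; []; _∷_; _∷ʳ_) renaming (_++_ to _++ˡ_)
open import Data.List.Relation.Unary.All using (All)
open import Data.Vec.Functional using (Vector; _++_) renaming (_∷_ to _∷ᵛ_)
open import Data.Product using (Σ; ∃; _×_; _,_)
open import Data.Empty using (⊥)
open import Relation.Nullary using (¬_)
open import Relation.Binary.PropositionalEquality using (_≡_; _≢_)
open import Function.Definitions using (Injective)

record Language : Set₁ where
  field
    Func : ℕ → Set
    Rel  : ℕ → Set

module _ (L : Language) where
  open Language L

  data Term (n : ℕ) : Set where
    var : Fin n → Term n
    app : ∀ {k} → Func k → (Fin k → Term n) → Term n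

  data Formula (n : ℕ) : Set where
    falsum : Formula n
    equal  : Term n → Term n → Formula n
    rel    : ∀ {k} → Rel k → (Fin k → Term n) → Formula n
    neg    : Formula n → Formula n
    conj   : Formula n → Formula n → Formula n
    ex     : Formula (suc n) → Formula n   -- binds variable 0

  record Structure : Set₁ where
    field
      Carrier : Set
      funᴹ    : ∀ {k} → Func k → (Fin k → Carrier) → Carrier
      relᴹ    : ∀ {k} → Rel k → (Fin k → Carrier) → Set

module _ {L : Language} (M : Structure L) where
  open Structure M

  eval : ∀ {n} → Term L n → Vector Carrier n → Carrier
  eval (var i) e = e i
  eval (app f ts) e = funᴹ f (λ j → eval (ts j) e)

  Sat : ∀ {n} → Formula L n → Vector Carrier n → Set
  Sat (falsum) e = ⊥
  Sat (equal s t) e = eval s e ≡ eval t e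
  Sat (rel R ts) e = relᴹ R (λ j → eval (ts j) e)
  Sat (neg φ) e = ¬ Sat φ e
  Sat (conj φ ψ) e = Sat φ e × Sat ψ e
  Sat (ex φ) e = Σ Carrier λ c → Sat φ (c ∷ᵛ e)

  Sat₂ : ∀ {n m} → Formula L (n + m) → Vector Carrier n → Vector Carrier m → Set
  Sat₂ {n} {m} φ b a = Sat φ (b ++ a)

  -- A set {φ(x̄, ā_i) : i ∈ I} of formulas with parameters is consistent
  -- (with the complete theory of M with parameters) iff it is finitely
  -- satisfiable in M.
  Consistent : ∀ {n m} {I : Set} → Formula L (n + m) → (I → Vector Carrier m) → Set
  Consistent {n} {m} φ a = ∀ (F : List _) → Σ (Vector Carrier n) λ b → All (λ i → Sat₂ {n} {m} φ b (a i)) F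

  Inconsistent₂ : ∀ {n m} → Formula L (n + m) → Vector Carrier m → Vector Carrier m → Set
  Inconsistent₂ {n} {m} φ a a' = ¬ Σ (Vector Carrier n) λ b → Sat₂ {n} {m} φ b a × Sat₂ {n} {m} φ b a'

-- Trees: ^{ω>}A as lists (η ⌢ ⟨i⟩ = η ∷ʳ i), ^ω A as functions ℕ → A

restrict : ∀ {A : Set} → (ℕ → A) → ℕ → List A
restrict ρ zero = []
restrict ρ (suc n) = restrict ρ n ∷ʳ ρ n

_⊴_ : ∀ {A : Set} → List A → List A → Set
ν ⊴ η = ∃ λ ζ → (ν ++ˡ ζ) ≡ η

module _ {L : Language} (M : Structure L) where
  open Structure M

  ExemplifiesSOP1 : ∀ {n m} → Formula L (n + m) → Set
  ExemplifiesSOP1 {n} {m} φ =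
    Σ (List Bool → Vector Carrier m) λ a →
      (∀ (ρ : ℕ → Bool) → Consistent M {n} {m} φ (λ k → a (restrict ρ k)))
    × (∀ (ν η : List Bool) → (ν ∷ʳ false) ⊴ η → Inconsistent₂ M {n} {m} φ (a η) (a (ν ∷ʳ true)))

  -- T = Th(M) has SOP₁
  HasSOP1 : Set
  HasSOP1 = Σ ℕ λ n → Σ ℕ λ m → Σ (Formula L (n + m)) λ φ → ExemplifiesSOP1 {n} {m} φ

  -- the tree property in the explicit form of the statement
  -- (children of every node pairwise contradictory, branches consistent)
  PairwiseTP : ∀ {n m} → Formula L (n + m) → Set
  PairwiseTP {n} {m} φ =
    Σ (List ℕ → Vector Carrier m) λ b →
      (∀ (ν : List ℕ) (k l : ℕ) → k ≢ l → Inconsistent₂ M {n} {m} φ (b (ν ∷ʳ k)) (b (ν ∷ʳ l)))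
    × (∀ (ρ : ℕ → ℕ) → Consistent M {n} {m} φ (λ k → b (restrict ρ k)))

  KInconsistent : ∀ {n m} {I : Set} → ℕ → Formula L (n + m) → (I → Vector Carrier m) → Set
  KInconsistent {n} {m} {I} k φ a =
    ∀ (f : Fin k → I) → Injective _≡_ _≡_ f →
      ¬ Σ (Vector Carrier n) λ b → ∀ j → Sat₂ M {n} {m} φ b (a (f j))

  TreeProperty : ∀ {n m} → Formula L (n + m) → Set
  TreeProperty {n} {m} φ =
    Σ ℕ λ k → 2 ≤ k × Σ (List ℕ → Vector Carrier m) λ b →
      (∀ (ν : List ℕ) → KInconsistent {n} {m} k φ (λ i → b (ν ∷ʳ i)))
    × (∀ (ρ : ℕ → ℕ) → Consistent M {n} {m} φ (λ i → b (restrict ρ i)))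

  Simple : Set
  Simple = ∀ (n m : ℕ) (φ : Formula L (n + m)) → ¬ TreeProperty {n} {m} φ

module Submission where

-- Code ν ∈ ω^{<ω} by the binary word η(ν) obtained by replacing each entry k
-- with the block 0ᵏ1, and put b_ν := a_{η(ν)}.  For k < l the words η(ν⌢k) and
-- η(ν⌢l) split exactly after η(ν)⌢0ᵏ, with η(ν⌢k) = η(ν)⌢0ᵏ⌢1 and η(ν⌢l)
-- extending η(ν)⌢0ᵏ⌢0, so clause (b) of SOP₁ makes φ(x̄, b_{ν⌢k}) and φ(x̄, b_{ν⌢l})
-- contradictory.  For a branch ρ ∈ ω^ω, the η(ρ↾n) are initial segments of the
-- single binary branch 0^{ρ(0)}1 0^{ρ(1)}1 …, so clause (a) of SOP₁ makes the
-- branch consistent.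

open import Defs
open import Data.Nat using (ℕ; zero; suc; _+_; _≤_; _<_; s≤s; z≤n)
open import Data.Nat.Properties using (≤-total; ≤∧≢⇒<)
open import Data.Bool using (Bool; true; false)
open import Data.Vec.Functional using (Vector)
open import Data.Fin using () renaming (zero to fzero; suc to fsuc)
open import Data.List using (List; []; _∷_; _∷ʳ_; [_]; _++_; replicate; concatMap; applyUpTo; map)
open import Data.List.Properties using (++-assoc; ++-identityʳ; ∷ʳ-++; concatMap-++; applyUpTo-∷ʳ)
open import Data.List.Relation.Unary.All using () renaming (map to All-map)
open import Data.List.Relation.Unary.All.Properties using (map⁻)
open import Data.Product using (_×_; _,_; ∃; ∃₂; proj₁; proj₂)
open import Function using (_∘_)
open import Relation.Binary.Consequences using (wlog)
open import Relation.Nullary using (¬_)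
open import Relation.Binary.PropositionalEquality
  using (_≡_; _≢_; refl; sym; trans; cong; subst; subst₂; module ≡-Reasoning)

restrict≡applyUpTo : ∀ {A : Set} (σ : ℕ → A) n → restrict σ n ≡ applyUpTo σ n
restrict≡applyUpTo σ zero = refl
restrict≡applyUpTo σ (suc n) = trans (cong (_∷ʳ σ n) (restrict≡applyUpTo σ n)) (applyUpTo-∷ʳ σ n)

block : ℕ → List Bool
block k = replicate k false ++ [ true ]

encode : List ℕ → List Bool
encode = concatMap block

encode-∷ʳ : ∀ ν k → encode (ν ∷ʳ k) ≡ encode ν ++ block k
encode-∷ʳ ν k = trans (concatMap-++ block ν [ k ]) (cong (encode ν ++_) (++-identityʳ (block k)))

block-< : ∀ {k l} → k < l → ∃ λ u → block l ≡ replicate k false ++ false ∷ u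
block-< {zero} {suc l} _ = block l , refl
block-< {suc k} {suc l} (s≤s k<l) = let u , e = block-< k<l in u , cong (false ∷_) e

encode-siblings : ∀ ν {k l} → k < l →
  ∃₂ λ w u → encode (ν ∷ʳ k) ≡ w ∷ʳ true × encode (ν ∷ʳ l) ≡ (w ∷ʳ false) ++ u
encode-siblings ν {k} {l} k<l = w , u , encode-left , encode-right
  where
  open ≡-Reasoning
  w : List Bool
  w = encode ν ++ replicate k false
  u : List Bool
  u = proj₁ (block-< k<l)

  encode-left : encode (ν ∷ʳ k) ≡ w ∷ʳ true
  encode-left = trans (encode-∷ʳ ν k) (sym (++-assoc (encode ν) (replicate k false) [ true ]))

  encode-right : encode (ν ∷ʳ l) ≡ (w ∷ʳ false) ++ u
  encode-right = begin
    encode (ν ∷ʳ l)                                ≡⟨ encode-∷ʳ ν l ⟩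
    encode ν ++ block l                            ≡⟨ cong (encode ν ++_) (proj₂ (block-< k<l)) ⟩
    encode ν ++ (replicate k false ++ false ∷ u)   ≡⟨ ++-assoc (encode ν) (replicate k false) (false ∷ u) ⟨
    w ++ false ∷ u                                 ≡⟨ ∷ʳ-++ w false u ⟨
    (w ∷ʳ false) ++ u                              ∎

-- blocksFrom c ρ is the binary branch 0ᶜ1 0^{ρ(1)}1 0^{ρ(2)}1 …
blocksFrom : ℕ → (ℕ → ℕ) → ℕ → Bool
blocksFrom zero ρ zero = true
blocksFrom zero ρ (suc i) = blocksFrom (ρ 1) (ρ ∘ suc) i
blocksFrom (suc c) ρ zero = false
blocksFrom (suc c) ρ (suc i) = blocksFrom c ρ i

blocks : (ℕ → ℕ) → ℕ → Bool
blocks ρ = blocksFrom (ρ 0) ρ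

applyUpTo-blocksFrom : ∀ c ρ j →
  applyUpTo (blocksFrom c ρ) (suc c + j) ≡ block c ++ applyUpTo (blocks (ρ ∘ suc)) j
applyUpTo-blocksFrom zero ρ j = refl
applyUpTo-blocksFrom (suc c) ρ j = cong (false ∷_) (applyUpTo-blocksFrom c ρ j)

encode-restrict-prefix : ∀ ρ n → ∃ λ N → restrict (blocks ρ) N ≡ encode (restrict ρ n)
encode-restrict-prefix ρ n =
  let N , e = encode-applyUpTo-prefix ρ n
  in N , trans (restrict≡applyUpTo (blocks ρ) N) (trans e (cong encode (sym (restrict≡applyUpTo ρ n))))
  where
  encode-applyUpTo-prefix : ∀ ρ n → ∃ λ N → applyUpTo (blocks ρ) N ≡ encode (applyUpTo ρ n)
  encode-applyUpTo-prefix ρ zero = 0 , refl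
  encode-applyUpTo-prefix ρ (suc n) =
    let N , e = encode-applyUpTo-prefix (ρ ∘ suc) n
    in suc (ρ 0) + N , trans (applyUpTo-blocksFrom (ρ 0) ρ N) (cong (block (ρ 0) ++_) e)

module _ {L : Language} (M : Structure L) {n m : ℕ} (φ : Formula L (n + m)) where
  open Structure M

  Inconsistent₂-sym : ∀ {a a'} → Inconsistent₂ M {n} {m} φ a a' → Inconsistent₂ M {n} {m} φ a' a
  Inconsistent₂-sym inconsistent (b , sat , sat') = inconsistent (b , sat' , sat)

  Consistent-subfamily : ∀ {I J : Set} {a : I → Vector Carrier m} {a' : J → Vector Carrier m} →
    (∀ j → ∃ λ i → a i ≡ a' j) → Consistent M {n} {m} φ a → Consistent M {n} {m} φ a'
  Consistent-subfamily member consistent F =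
    let b , sats = consistent (map (proj₁ ∘ member) F)
    in b , All-map (λ {j} → subst (Sat₂ M {n} {m} φ b) (proj₂ (member j))) (map⁻ sats)

  sop1⇒pairwiseTP : ExemplifiesSOP1 M {n} {m} φ → PairwiseTP M {n} {m} φ
  sop1⇒pairwiseTP (a , branch-consistent , inconsistent) = a ∘ encode , siblings , branches
    where
    Contradictory : List ℕ → ℕ → ℕ → Set
    Contradictory ν k l = k ≢ l → Inconsistent₂ M {n} {m} φ (a (encode (ν ∷ʳ k))) (a (encode (ν ∷ʳ l)))

    siblings-≤ : ∀ ν k l → k ≤ l → Contradictory ν k l
    siblings-≤ ν k l k≤l k≢l with encode-siblings ν (≤∧≢⇒< k≤l k≢l)
    ... | w , u , left , right =
      subst₂ (Inconsistent₂ M {n} {m} φ) (cong a (sym left)) (cong a (sym right))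
        (Inconsistent₂-sym (inconsistent w ((w ∷ʳ false) ++ u) (u , refl)))

    siblings : ∀ ν k l → Contradictory ν k l
    siblings ν = wlog ≤-total (λ c l≢k → Inconsistent₂-sym (c (l≢k ∘ sym))) (siblings-≤ ν)

    branches : ∀ ρ → Consistent M {n} {m} φ (a ∘ encode ∘ restrict ρ)
    branches ρ = Consistent-subfamily
      (λ k → let N , e = encode-restrict-prefix ρ k in N , cong a e)
      (branch-consistent (blocks ρ))

  pairwiseTP⇒treeProperty : PairwiseTP M {n} {m} φ → TreeProperty M {n} {m} φ
  pairwiseTP⇒treeProperty (b , siblings , branches) = 2 , s≤s (s≤s z≤n) , b , inconsistent₂ , branches
    where
    inconsistent₂ : ∀ ν → KInconsistent M {n} {m} 2 φ (b ∘ (ν ∷ʳ_))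
    inconsistent₂ ν f injective (c , sat) =
      siblings ν (f fzero) (f (fsuc fzero)) (λ e → 0≢1 (injective e)) (c , sat fzero , sat (fsuc fzero))
      where
      0≢1 : fzero ≢ fsuc fzero
      0≢1 ()

claim3p9 : (L : Language) (M : Structure L) →
    ((n m : ℕ) (φ : Formula L (n + m)) → ExemplifiesSOP1 M {n} {m} φ → PairwiseTP M {n} {m} φ)
    × (HasSOP1 M → ¬ Simple M)
claim3p9 L M =
  (λ n m φ → sop1⇒pairwiseTP M φ) ,
  λ (n , m , φ , sop1) simple → simple n m φ (pairwiseTP⇒treeProperty M φ (sop1⇒pairwiseTP M φ sop1))
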